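{- The elements $T^n$ and $T^{ -n}[a^ib^j,T]$ (for integers $i,j\ge0$) lie in $R_{\mathrm{Heis}_n}$, and in $R^{ab}$ (written additively) one has \begin{align*} T^n&=a^n-(a^n)^\beta-\sum_{k=0}^{n-2}\sum_{i=0}^{n-2-k}[a,T]^{\tau^k\alpha^i},\\ T^{ -n}&=b^n-(b^n)^\alpha-\sum_{k=0}^{n-2}\sum_{j=0}^{n-2-k}[b,T^{ -1}]^{\tau^{ -k}\beta^j},\\ [a^ib^j,T]&=[b,T]^{\alpha^i\sum_{\lambda=0}^{j-1}\beta^\lambda}+[a,T]^{\sum_{\lambda=0}^{i-1}\alpha^\lambda}. \end{align*}
   Context: $F_2$ is the free group on $a,b$; $[x,y]=xyx^{ -1}y^{ -1}$, $x^y=yxy^{ -1}$, $T=[a,b]$. $H_n$ is the group of $3\times3$ upper unitriangular matrices over $\mathbb{Z}/n\mathbb{Z}$, $\alpha$ (resp. $\beta$) the matrix with $1$ at position $(1,2)$ (resp. $(2,3)$), $\tau=[\alpha,\beta]$. $R_{\mathrm{Heis}_n}$ is the kernel of $F_2\to H_n$, $a\mapsto\alpha$, $b\mapsto\beta$, and $R^{ab}$ its abelianization, written additively. Conjugation by $F_2$ on $R^{ab}$ factors through $H_n$; for $x\in R^{ab}$, $h\in H_n$, $x^h$ denotes this action (so $x^{\alpha}=axa^{ -1}$, $x^{\beta}=bxb^{ -1}$, $x^\tau=TxT^{ -1}$, and $x^{gh}=(x^h)^g$), extended $\mathbb{Z}$-linearly: $x^{\sum c_h h}=\sum c_h x^h$.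 -}

module Defs where

open import Data.Bool using (Bool; true; false; not)
open import Data.Nat using (ℕ; zero; suc; _∸_)
open import Data.Integer using (ℤ; +_; -_; _+_; _*_)
open import Data.Integer.Divisibility using (_∣_)
open import Data.List using (List; []; _∷_; _++_; map; reverse; foldr; concatMap; upTo)
open import Data.Product using (_×_; _,_)

data Gen : Set where
  ga gb : Gen

-- A letter: generator with exponent sign (true = +1, false = -1)
Letter : Set
Letter = Gen × Bool

flipL : Letter → Letter
flipL (g , s) = (g , not s)

-- Words in a, b, a⁻¹, b⁻¹ represent elements of F₂ (up to free equivalence _∼_)
Word : Set
Word = List Letter

data _∼_ : Word → Word → Set where
  ∼-refl  : ∀ {u} → u ∼ u
  ∼-sym   : ∀ {u v} → u ∼ v → v ∼ u
  ∼-trans : ∀ {u v w} → u ∼ v → v ∼ w → u ∼ w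
  ∼-step  : ∀ u v l → (u ++ l ∷ flipL l ∷ v) ∼ (u ++ v)

inv : Word → Word
inv w = reverse (map flipL w)

pow : Word → ℕ → Word
pow w zero    = []
pow w (suc k) = w ++ pow w k

A B : Word
A = (ga , true) ∷ []
B = (gb , true) ∷ []

comm : Word → Word → Word
comm x y = x ++ y ++ inv x ++ inv y

-- x ↦ g x g⁻¹ (conjugation; x^h for h the image of g)
conj : Word → Word → Word
conj g x = g ++ x ++ inv g

T Ti : Word
T  = comm A B
Ti = inv T

-- Heisenberg group over ℤ: (x,y,z) ↔ [[1,x,z],[0,1,y],[0,0,1]]
Heis : Set
Heis = ℤ × ℤ × ℤ

hmul : Heis → Heis → Heis
hmul (x , y , z) (x' , y' , z') = (x + x' , y + y' , z + z' + x * y')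

hone : Heis
hone = (+ 0 , + 0 , + 0)

letterH : Letter → Heis
letterH (ga , true)  = (+ 1 , + 0 , + 0)
letterH (ga , false) = (- (+ 1) , + 0 , + 0)
letterH (gb , true)  = (+ 0 , + 1 , + 0)
letterH (gb , false) = (+ 0 , - (+ 1) , + 0)

-- the homomorphism F₂ → H_ℤ, a ↦ α, b ↦ β
evalH : Word → Heis
evalH w = foldr (λ l h → hmul (letterH l) h) hone w

-- w ∈ R_Heis_n : the image of w in H_n (reduction mod n of H_ℤ) is trivial
InR : ℕ → Word → Set
InR n w with evalH w
... | (x , y , z) = ((+ n) ∣ x) × ((+ n) ∣ y) × ((+ n) ∣ z)

data InRR (n : ℕ) : Word → Set where
  rr-comm : ∀ {r s} → InR n r → InR n s → InRR n (comm r s)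
  rr-one  : InRR n []
  rr-mul  : ∀ {u v} → InRR n u → InRR n v → InRR n (u ++ v)
  rr-inv  : ∀ {u} → InRR n u → InRR n (inv u)
  rr-resp : ∀ {u v} → u ∼ v → InRR n u → InRR n v

-- equality in R^{ab} = R/[R,R] (for x, y ∈ R): x y⁻¹ ∈ [R,R]
-- (additive notation: x + y ↔ x ++ y, -x ↔ inv x)
_≈[_]_ : Word → ℕ → Word → Set
x ≈[ n ] y = InRR n (x ++ inv y)

Σ : {X : Set} → List X → (X → Word) → Word
Σ xs f = concatMap f xs

{-# OPTIONS --safe #-}

-- In F₂ one has [xy,z] = [y,z]^x [x,z]. If [g,z] ∈ R, iterating this gives
-- [g^m,z] = Σ_{l<m} [g,z]^{g^l} in Rᵃᵇ, because elements of R commute modulo [R,R];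
-- for g = a, b and z = T this yields the formula for [a^i b^j,T].
-- Next, [g^{m+1},h] = [g,h]^{g^m} [g^m,h] and [g,h]^{g^m} = [g^m,[g,h]] [g,h], so by
-- induction [g^m,h] = S_m [g,h]^m in Rᵃᵇ, where S_m is the double sum of conjugates of
-- [g,[g,h]] appearing in the statement. For m = n the left side is g^n − (g^n)^h, and
-- conjugation by S_n ∈ R fixes [g,h]^n ∈ R in Rᵃᵇ; (g,h) = (a,b) and (b,a) give the
-- formulas for T^n and T^{-n} = [b,a]^n.
-- Membership in R is read off the image in H_ℤ, where commutators are central: so
-- [u,[v,w]] maps to 1 and [u,v]^n to the n-th power of a central element.

module Submission where

open import Defs
open import Data.Bool using (true; false)
open import Data.Nat using (ℕ; zero; suc; _∸_)
open import Data.Integer using (ℤ; +_; +0; -_; _+_; _-_; _*_)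
import Data.Integer.Properties as ℤ
open import Data.Integer.Divisibility.Signed
  using (_∣_; divides; ∣ᵤ⇒∣; ∣⇒∣ᵤ; ∣-refl; ∣m∣n⇒∣m+n; ∣m∣n⇒∣m-n; ∣m⇒∣m*n; ∣n⇒∣m*n)
import Data.Integer.Tactic.RingSolver as ℤ-Solver
open import Data.List using (List; []; _∷_; _++_; map; reverse; upTo; concatMap)
open import Data.List.Properties
  using (++-assoc; ++-identityʳ; ++-monoid; map-++; reverse-++; map-upTo; concatMap-map)
open import Data.Product using (_×_; _,_)
open import Function using (_∘_)
open import Relation.Binary.Bundles using (Setoid)
open import Relation.Binary.PropositionalEquality
  using (_≡_; refl; sym; trans; cong; cong₂; subst; subst₂; module ≡-Reasoning)
import Relation.Binary.Reasoning.Base.Single as SingleRelReasoning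
import Relation.Binary.Reasoning.Setoid as SetoidReasoning
open import Relation.Binary.Reasoning.Syntax using (module ∼-syntax)
import Tactic.MonoidSolver as Monoid

-- Words modulo free reduction

∼-reflexive : ∀ {u v} → u ≡ v → u ∼ v
∼-reflexive refl = ∼-refl

module ∼-Reasoning = SingleRelReasoning _∼_ ∼-refl ∼-trans

++-congˡ : ∀ w {u v} → u ∼ v → (w ++ u) ∼ (w ++ v)
++-congˡ w ∼-refl          = ∼-refl
++-congˡ w (∼-sym p)       = ∼-sym (++-congˡ w p)
++-congˡ w (∼-trans p q)   = ∼-trans (++-congˡ w p) (++-congˡ w q)
++-congˡ w (∼-step u v l)  =
  subst₂ _∼_ (++-assoc w u _) (++-assoc w u v) (∼-step (w ++ u) v l)

++-congʳ : ∀ w {u v} → u ∼ v → (u ++ w) ∼ (v ++ w)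
++-congʳ w ∼-refl          = ∼-refl
++-congʳ w (∼-sym p)       = ∼-sym (++-congʳ w p)
++-congʳ w (∼-trans p q)   = ∼-trans (++-congʳ w p) (++-congʳ w q)
++-congʳ w (∼-step u v l)  =
  subst₂ _∼_ (sym (++-assoc u (l ∷ flipL l ∷ v) w)) (sym (++-assoc u v w)) (∼-step u (v ++ w) l)

++-cong : ∀ {u u′ v v′} → u ∼ u′ → v ∼ v′ → (u ++ v) ∼ (u′ ++ v′)
++-cong {u′ = u′} {v = v} p q = ∼-trans (++-congʳ v p) (++-congˡ u′ q)

flipL-involutive : ∀ l → flipL (flipL l) ≡ l
flipL-involutive (g , true)  = refl
flipL-involutive (g , false) = refl

inv-++ : ∀ u v → inv (u ++ v) ≡ inv v ++ inv u
inv-++ u v = trans (cong reverse (map-++ flipL u v)) (reverse-++ (map flipL u) (map flipL v))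

inv-involutive : ∀ u → inv (inv u) ≡ u
inv-involutive []      = refl
inv-involutive (l ∷ u) = begin
  inv (inv (l ∷ u))             ≡⟨ cong inv (inv-++ (l ∷ []) u) ⟩
  inv (inv u ++ flipL l ∷ [])   ≡⟨ inv-++ (inv u) (flipL l ∷ []) ⟩
  flipL (flipL l) ∷ inv (inv u) ≡⟨ cong₂ _∷_ (flipL-involutive l) (inv-involutive u) ⟩
  l ∷ u                         ∎
  where open ≡-Reasoning

++-inverseʳ : ∀ u → (u ++ inv u) ∼ []
++-inverseʳ []      = ∼-refl
++-inverseʳ (l ∷ u) = begin
  l ∷ u ++ inv (l ∷ u)                ≡⟨ cong (λ v → l ∷ u ++ v) (inv-++ (l ∷ []) u) ⟩
  l ∷ u ++ inv u ++ flipL l ∷ []      ≡⟨ cong (l ∷_) (++-assoc u (inv u) _) ⟨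
  l ∷ (u ++ inv u) ++ flipL l ∷ []    ∼⟨ ++-congˡ (l ∷ []) (++-congʳ _ (++-inverseʳ u)) ⟩
  [] ++ l ∷ flipL l ∷ []              ∼⟨ ∼-step [] [] l ⟩
  []                                  ∎
  where open ∼-Reasoning

++-inverseˡ : ∀ u → (inv u ++ u) ∼ []
++-inverseˡ u = subst (λ v → (inv u ++ v) ∼ []) (inv-involutive u) (++-inverseʳ (inv u))

erase : ∀ p q {c} → c ∼ [] → (p ++ c ++ q) ∼ (p ++ q)
erase p q c∼[] = ++-congˡ p (++-congʳ q c∼[])

comm-++ˡ : ∀ x y z → comm (x ++ y) z ∼ (conj x (comm y z) ++ comm x z)
comm-++ˡ x y z = ∼-sym (begin
  (x ++ (y ++ z ++ inv y ++ inv z) ++ inv x) ++ (x ++ z ++ inv x ++ inv z)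
    ≡⟨ Monoid.solve (++-monoid Letter) ⟩
  (x ++ y ++ z ++ inv y ++ inv z) ++ (inv x ++ x) ++ (z ++ inv x ++ inv z)
    ∼⟨ erase (x ++ y ++ z ++ inv y ++ inv z) (z ++ inv x ++ inv z) (++-inverseˡ x) ⟩
  (x ++ y ++ z ++ inv y ++ inv z) ++ (z ++ inv x ++ inv z)
    ≡⟨ Monoid.solve (++-monoid Letter) ⟩
  (x ++ y ++ z ++ inv y) ++ (inv z ++ z) ++ (inv x ++ inv z)
    ∼⟨ erase (x ++ y ++ z ++ inv y) (inv x ++ inv z) (++-inverseˡ z) ⟩
  (x ++ y ++ z ++ inv y) ++ (inv x ++ inv z)
    ≡⟨ Monoid.solve (++-monoid Letter) ⟩
  (x ++ y) ++ z ++ (inv y ++ inv x) ++ inv z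
    ≡⟨ cong (λ w → (x ++ y) ++ z ++ w ++ inv z) (inv-++ x y) ⟨
  comm (x ++ y) z ∎)
  where open ∼-Reasoning

conj-as-comm : ∀ g u → conj g u ∼ (comm g u ++ u)
conj-as-comm g u = ∼-sym (begin
  (g ++ u ++ inv g ++ inv u) ++ u          ≡⟨ Monoid.solve (++-monoid Letter) ⟩
  (g ++ u ++ inv g) ++ (inv u ++ u) ++ []  ∼⟨ erase (g ++ u ++ inv g) [] (++-inverseˡ u) ⟩
  (g ++ u ++ inv g) ++ []                  ≡⟨ ++-identityʳ _ ⟩
  conj g u                                 ∎)
  where open ∼-Reasoning

conj-cong : ∀ g {u v} → u ∼ v → conj g u ∼ conj g v
conj-cong g u∼v = ++-congˡ g (++-congʳ (inv g) u∼v)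

conj-[] : ∀ g → conj g [] ∼ []
conj-[] = ++-inverseʳ

conj-++ : ∀ g u v → conj g (u ++ v) ∼ (conj g u ++ conj g v)
conj-++ g u v = ∼-sym (begin
  (g ++ u ++ inv g) ++ (g ++ v ++ inv g)  ≡⟨ Monoid.solve (++-monoid Letter) ⟩
  (g ++ u) ++ (inv g ++ g) ++ (v ++ inv g) ∼⟨ erase (g ++ u) (v ++ inv g) (++-inverseˡ g) ⟩
  (g ++ u) ++ (v ++ inv g)                 ≡⟨ Monoid.solve (++-monoid Letter) ⟩
  conj g (u ++ v)                          ∎)
  where open ∼-Reasoning

conj-conj : ∀ g h u → conj g (conj h u) ≡ conj (g ++ h) u
conj-conj g h u = begin
  g ++ (h ++ u ++ inv h) ++ inv g    ≡⟨ Monoid.solve (++-monoid Letter) ⟩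
  (g ++ h) ++ u ++ (inv h ++ inv g)  ≡⟨ cong (λ w → (g ++ h) ++ u ++ w) (inv-++ g h) ⟨
  conj (g ++ h) u                    ∎
  where open ≡-Reasoning

inv-conj : ∀ g u → inv (conj g u) ≡ conj g (inv u)
inv-conj g u = begin
  inv (g ++ u ++ inv g)            ≡⟨ inv-++ g (u ++ inv g) ⟩
  inv (u ++ inv g) ++ inv g        ≡⟨ cong (_++ inv g) (inv-++ u (inv g)) ⟩
  (inv (inv g) ++ inv u) ++ inv g  ≡⟨ cong (λ w → (w ++ inv u) ++ inv g) (inv-involutive g) ⟩
  (g ++ inv u) ++ inv g            ≡⟨ ++-assoc g (inv u) (inv g) ⟩
  conj g (inv u)                   ∎
  where open ≡-Reasoning

conj-comm : ∀ g r s → conj g (comm r s) ∼ comm (conj g r) (conj g s)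
conj-comm g r s = begin
  conj g (r ++ s ++ inv r ++ inv s)
    ∼⟨ conj-++ g r _ ⟩
  conj g r ++ conj g (s ++ inv r ++ inv s)
    ∼⟨ ++-congˡ (conj g r) (conj-++ g s _) ⟩
  conj g r ++ conj g s ++ conj g (inv r ++ inv s)
    ∼⟨ ++-congˡ (conj g r) (++-congˡ (conj g s) (conj-++ g (inv r) (inv s))) ⟩
  conj g r ++ conj g s ++ conj g (inv r) ++ conj g (inv s)
    ≡⟨ cong₂ (λ u v → conj g r ++ conj g s ++ u ++ v) (inv-conj g r) (inv-conj g s) ⟨
  comm (conj g r) (conj g s) ∎
  where open ∼-Reasoning

conj-Σ : ∀ {X : Set} g (xs : List X) f → conj g (Σ xs f) ∼ Σ xs (conj g ∘ f)
conj-Σ g []       f = conj-[] g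
conj-Σ g (x ∷ xs) f = ∼-trans (conj-++ g (f x) _) (++-congˡ (conj g (f x)) (conj-Σ g xs f))

Σ-cong : ∀ {X : Set} (xs : List X) {f g} → (∀ x → f x ∼ g x) → Σ xs f ∼ Σ xs g
Σ-cong []       f∼g = ∼-refl
Σ-cong (x ∷ xs) f∼g = ++-cong (f∼g x) (Σ-cong xs f∼g)

Σ-upTo-suc : ∀ m f → Σ (upTo (suc m)) f ≡ f 0 ++ Σ (upTo m) (f ∘ suc)
Σ-upTo-suc m f =
  cong (f 0 ++_) (trans (cong (concatMap f) (sym (map-upTo suc m))) (concatMap-map f suc (upTo m)))

pow-suc-snoc : ∀ w m → pow w (suc m) ≡ pow w m ++ w
pow-suc-snoc w zero    = ++-identityʳ w
pow-suc-snoc w (suc m) = trans (cong (w ++_) (pow-suc-snoc w m)) (sym (++-assoc w (pow w m) w))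

nestedSum : Word → Word → ℕ → Word
nestedSum g h m =
  Σ (upTo (m ∸ 1)) (λ k → Σ (upTo (m ∸ 1 ∸ k)) (λ i →
    conj (pow (comm g h) k ++ pow g i) (comm g (comm g h))))

nestedSum-suc : ∀ g h m →
  (Σ (upTo m) (λ i → conj (pow g i) (comm g (comm g h))) ++ conj (comm g h) (nestedSum g h m))
    ∼ nestedSum g h (suc m)
nestedSum-suc g h zero    = conj-[] (comm g h)
nestedSum-suc g h (suc m) = begin
  P ++ conj t (Σ (upTo m) (λ k → Σ (upTo (m ∸ k)) (F k)))
    ∼⟨ ++-congˡ P (conj-Σ t (upTo m) _) ⟩
  P ++ Σ (upTo m) (λ k → conj t (Σ (upTo (m ∸ k)) (F k)))
    ∼⟨ ++-congˡ P (Σ-cong (upTo m) λ k →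
         ∼-trans (conj-Σ t (upTo (m ∸ k)) (F k)) (Σ-cong (upTo (m ∸ k)) (∼-reflexive ∘ conj-F k))) ⟩
  P ++ Σ (upTo m) (λ k → Σ (upTo (m ∸ k)) (F (suc k)))
    ≡⟨ Σ-upTo-suc m _ ⟨
  nestedSum g h (suc (suc m)) ∎
  where
  open ∼-Reasoning
  t = comm g h
  F : ℕ → ℕ → Word
  F k i = conj (pow t k ++ pow g i) (comm g t)
  P = Σ (upTo (suc m)) (F 0)
  conj-F : ∀ k i → conj t (F k i) ≡ F (suc k) i
  conj-F k i = trans (conj-conj t _ _)
    (cong (λ w → conj w (comm g t)) (sym (++-assoc t (pow t k) (pow g i))))

-- The image in the Heisenberg group

central : ℤ → Heis
central c = (+0 , +0 , c)

hinv : Heis → Heis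
hinv (x , y , z) = (- x , - y , - z + x * y)

hcomm : Heis → Heis → Heis
hcomm g h = hmul g (hmul h (hmul (hinv g) (hinv h)))

det : Heis → Heis → ℤ
det (x , y , _) (x′ , y′ , _) = x * y′ - y * x′

≡-heis : ∀ {x y z x′ y′ z′ : ℤ} → x ≡ x′ → y ≡ y′ → z ≡ z′ → (x , y , z) ≡ (x′ , y′ , z′)
≡-heis refl refl refl = refl

hmul-assoc : ∀ f g h → hmul f (hmul g h) ≡ hmul (hmul f g) h
hmul-assoc (x , y , z) (x′ , y′ , z′) (x″ , y″ , z″) =
  ≡-heis (sym (ℤ.+-assoc x x′ x″)) (sym (ℤ.+-assoc y y′ y″)) (third x y z x′ y′ z′ x″ y″ z″)
  where
  third : ∀ x y z x′ y′ z′ x″ y″ z″ →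
    z + (z′ + z″ + x′ * y″) + x * (y′ + y″) ≡ z + z′ + x * y′ + z″ + (x + x′) * y″
  third = ℤ-Solver.solve-∀

hmul-identityˡ : ∀ h → hmul hone h ≡ h
hmul-identityˡ (x , y , z) = ≡-heis (ℤ.+-identityˡ x) (ℤ.+-identityˡ y) (third y z)
  where
  third : ∀ y z → +0 + z + +0 * y ≡ z
  third = ℤ-Solver.solve-∀

hmul-identityʳ : ∀ h → hmul h hone ≡ h
hmul-identityʳ (x , y , z) = ≡-heis (ℤ.+-identityʳ x) (ℤ.+-identityʳ y) (third x z)
  where
  third : ∀ x z → z + +0 + x * +0 ≡ z
  third = ℤ-Solver.solve-∀

hmul-inverseʳ : ∀ h → hmul h (hinv h) ≡ hone
hmul-inverseʳ (x , y , z) = ≡-heis (ℤ.+-inverseʳ x) (ℤ.+-inverseʳ y) (third x y z)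
  where
  third : ∀ x y z → z + (- z + x * y) + x * - y ≡ +0
  third = ℤ-Solver.solve-∀

hmul-central : ∀ c d → hmul (central c) (central d) ≡ central (c + d)
hmul-central c d = cong central (ℤ.+-identityʳ (c + d))

hcomm≡central-det : ∀ g h → hcomm g h ≡ central (det g h)
hcomm≡central-det (x , y , z) (x′ , y′ , z′) =
  ≡-heis (cancel x x′) (cancel y y′) (third x y z x′ y′ z′)
  where
  cancel : ∀ x x′ → x + (x′ + (- x + - x′)) ≡ +0
  cancel = ℤ-Solver.solve-∀
  third : ∀ x y z x′ y′ z′ →
    z + (z′ + (- z + x * y + (- z′ + x′ * y′) + - x * - y′) + x′ * (- y + - y′))
      + x * (y′ + (- y + - y′))
    ≡ x * y′ - y * x′
  third = ℤ-Solver.solve-∀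

det-central : ∀ g c → det g (central c) ≡ +0
det-central (x , y , _) c = vanish x y
  where
  vanish : ∀ x y → x * +0 - y * +0 ≡ +0
  vanish = ℤ-Solver.solve-∀

evalH-++ : ∀ u v → evalH (u ++ v) ≡ hmul (evalH u) (evalH v)
evalH-++ []      v = sym (hmul-identityˡ (evalH v))
evalH-++ (l ∷ u) v =
  trans (cong (hmul (letterH l)) (evalH-++ u v)) (hmul-assoc (letterH l) (evalH u) (evalH v))

letterH-flipL : ∀ l → hmul (letterH l) (letterH (flipL l)) ≡ hone
letterH-flipL (ga , true)  = refl
letterH-flipL (ga , false) = refl
letterH-flipL (gb , true)  = refl
letterH-flipL (gb , false) = refl

evalH-cancel : ∀ l v → evalH (l ∷ flipL l ∷ v) ≡ evalH v
evalH-cancel l v = begin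
  hmul L (hmul L⁻ V)  ≡⟨ hmul-assoc L L⁻ V ⟩
  hmul (hmul L L⁻) V  ≡⟨ cong (λ h → hmul h V) (letterH-flipL l) ⟩
  hmul hone V         ≡⟨ hmul-identityˡ V ⟩
  V                   ∎
  where
  open ≡-Reasoning
  L  = letterH l
  L⁻ = letterH (flipL l)
  V  = evalH v

evalH-resp-∼ : ∀ {u v} → u ∼ v → evalH u ≡ evalH v
evalH-resp-∼ ∼-refl         = refl
evalH-resp-∼ (∼-sym p)      = sym (evalH-resp-∼ p)
evalH-resp-∼ (∼-trans p q)  = trans (evalH-resp-∼ p) (evalH-resp-∼ q)
evalH-resp-∼ (∼-step u v l) = begin
  evalH (u ++ l ∷ flipL l ∷ v)              ≡⟨ evalH-++ u _ ⟩
  hmul (evalH u) (evalH (l ∷ flipL l ∷ v))  ≡⟨ cong (hmul (evalH u)) (evalH-cancel l v) ⟩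
  hmul (evalH u) (evalH v)                  ≡⟨ evalH-++ u v ⟨
  evalH (u ++ v)                            ∎
  where open ≡-Reasoning

evalH-inv : ∀ u → evalH (inv u) ≡ hinv (evalH u)
evalH-inv u = begin
  I                                ≡⟨ hmul-identityʳ I ⟨
  hmul I hone                      ≡⟨ cong (hmul I) (hmul-inverseʳ U) ⟨
  hmul I (hmul U (hinv U))         ≡⟨ hmul-assoc I U (hinv U) ⟩
  hmul (hmul I U) (hinv U)         ≡⟨ cong (λ h → hmul h (hinv U)) (evalH-++ (inv u) u) ⟨
  hmul (evalH (inv u ++ u)) (hinv U)
                                   ≡⟨ cong (λ h → hmul h (hinv U)) (evalH-resp-∼ (++-inverseˡ u)) ⟩
  hmul hone (hinv U)               ≡⟨ hmul-identityˡ (hinv U) ⟩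
  hinv U                           ∎
  where
  open ≡-Reasoning
  I = evalH (inv u)
  U = evalH u

evalH-comm : ∀ u v → evalH (comm u v) ≡ central (det (evalH u) (evalH v))
evalH-comm u v = begin
  evalH (u ++ v ++ inv u ++ inv v)
    ≡⟨ evalH-++ u _ ⟩
  hmul (evalH u) (evalH (v ++ inv u ++ inv v))
    ≡⟨ cong (hmul (evalH u)) (evalH-++ v _) ⟩
  hmul (evalH u) (hmul (evalH v) (evalH (inv u ++ inv v)))
    ≡⟨ cong (λ h → hmul (evalH u) (hmul (evalH v) h)) (evalH-++ (inv u) (inv v)) ⟩
  hmul (evalH u) (hmul (evalH v) (hmul (evalH (inv u)) (evalH (inv v))))
    ≡⟨ cong₂ (λ h k → hmul (evalH u) (hmul (evalH v) (hmul h k))) (evalH-inv u) (evalH-inv v) ⟩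
  hcomm (evalH u) (evalH v)
    ≡⟨ hcomm≡central-det (evalH u) (evalH v) ⟩
  central (det (evalH u) (evalH v)) ∎
  where open ≡-Reasoning

evalH-comm-comm : ∀ u v w → evalH (comm u (comm v w)) ≡ hone
evalH-comm-comm u v w = begin
  evalH (comm u (comm v w))                   ≡⟨ evalH-comm u (comm v w) ⟩
  central (det (evalH u) (evalH (comm v w)))  ≡⟨ cong (central ∘ det (evalH u)) (evalH-comm v w) ⟩
  central (det (evalH u) (central c))         ≡⟨ cong central (det-central (evalH u) c) ⟩
  hone                                        ∎
  where
  open ≡-Reasoning
  c = det (evalH v) (evalH w)

evalH-pow-central : ∀ w c m → evalH w ≡ central c → evalH (pow w m) ≡ central (+ m * c)
evalH-pow-central w c zero    _  = cong central (sym (ℤ.*-zeroˡ c))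
evalH-pow-central w c (suc m) eq = begin
  evalH (w ++ pow w m)                       ≡⟨ evalH-++ w (pow w m) ⟩
  hmul (evalH w) (evalH (pow w m))           ≡⟨ cong₂ hmul eq (evalH-pow-central w c m eq) ⟩
  hmul (central c) (central (+ m * c))       ≡⟨ hmul-central c (+ m * c) ⟩
  central (c + + m * c)                      ≡⟨ cong central (ℤ.suc-* (+ m) c) ⟨
  central (+ suc m * c)                      ∎
  where open ≡-Reasoning

-- Membership in R

-- n ∣ᴴ h says that h maps to 1 in H_n; InR n w is the same statement about evalH w,
-- phrased with unsigned divisibility.
infix 4 _∣ᴴ_
_∣ᴴ_ : ℕ → Heis → Set
n ∣ᴴ (x , y , z) = (+ n ∣ x) × (+ n ∣ y) × (+ n ∣ z)

∣ᴴ-central : ∀ {n c} → + n ∣ c → n ∣ᴴ central c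
∣ᴴ-central n∣c = divides +0 refl , divides +0 refl , n∣c

∣ᴴ-hmul : ∀ {n} g h → n ∣ᴴ g → n ∣ᴴ h → n ∣ᴴ hmul g h
∣ᴴ-hmul (x , y , z) (x′ , y′ , z′) (n∣x , n∣y , n∣z) (n∣x′ , n∣y′ , n∣z′) =
  ∣m∣n⇒∣m+n n∣x n∣x′ , ∣m∣n⇒∣m+n n∣y n∣y′ , ∣m∣n⇒∣m+n (∣m∣n⇒∣m+n n∣z n∣z′) (∣m⇒∣m*n y′ n∣x)

∣-det : ∀ {n} g h → n ∣ᴴ h → + n ∣ det g h
∣-det (x , y , _) (x′ , y′ , _) (n∣x′ , n∣y′ , _) = ∣m∣n⇒∣m-n (∣n⇒∣m*n x n∣y′) (∣n⇒∣m*n y n∣x′)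

module _ (n : ℕ) where

  InR⇒∣ᴴ : ∀ w → InR n w → n ∣ᴴ evalH w
  InR⇒∣ᴴ w (n∣x , n∣y , n∣z) = ∣ᵤ⇒∣ n∣x , ∣ᵤ⇒∣ n∣y , ∣ᵤ⇒∣ n∣z

  ∣ᴴ⇒InR : ∀ w → n ∣ᴴ evalH w → InR n w
  ∣ᴴ⇒InR w (n∣x , n∣y , n∣z) = ∣⇒∣ᵤ n∣x , ∣⇒∣ᵤ n∣y , ∣⇒∣ᵤ n∣z

  InR-resp-∼ : ∀ {u v} → u ∼ v → InR n u → InR n v
  InR-resp-∼ {u} {v} u∼v u∈R = ∣ᴴ⇒InR v (subst (n ∣ᴴ_) (evalH-resp-∼ u∼v) (InR⇒∣ᴴ u u∈R))

  InR-++ : ∀ u v → InR n u → InR n v → InR n (u ++ v)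
  InR-++ u v u∈R v∈R = ∣ᴴ⇒InR (u ++ v)
    (subst (n ∣ᴴ_) (sym (evalH-++ u v)) (∣ᴴ-hmul (evalH u) (evalH v) (InR⇒∣ᴴ u u∈R) (InR⇒∣ᴴ v v∈R)))

  InR-central : ∀ w {c} → evalH w ≡ central c → + n ∣ c → InR n w
  InR-central w eq n∣c = ∣ᴴ⇒InR w (subst (n ∣ᴴ_) (sym eq) (∣ᴴ-central n∣c))

  InR-kernel : ∀ w → evalH w ≡ hone → InR n w
  InR-kernel w eq = InR-central w eq (divides +0 refl)

  InR-comm : ∀ g r → InR n r → InR n (comm g r)
  InR-comm g r r∈R =
    InR-central (comm g r) (evalH-comm g r) (∣-det (evalH g) (evalH r) (InR⇒∣ᴴ r r∈R))

  InR-conj : ∀ g r → InR n r → InR n (conj g r)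
  InR-conj g r r∈R =
    InR-resp-∼ (∼-sym (conj-as-comm g r)) (InR-++ (comm g r) r (InR-comm g r r∈R) r∈R)

  InR-Σ : ∀ {X : Set} (xs : List X) f → (∀ x → InR n (f x)) → InR n (Σ xs f)
  InR-Σ []       f f∈R = InR-kernel [] refl
  InR-Σ (x ∷ xs) f f∈R = InR-++ (f x) (Σ xs f) (f∈R x) (InR-Σ xs f f∈R)

  InR-comm-comm : ∀ u v w → InR n (comm u (comm v w))
  InR-comm-comm u v w = InR-kernel (comm u (comm v w)) (evalH-comm-comm u v w)

  InR-pow-comm : ∀ u v → InR n (pow (comm u v) n)
  InR-pow-comm u v = InR-central (pow (comm u v) n)
    (evalH-pow-central (comm u v) _ n (evalH-comm u v)) (∣m⇒∣m*n (det (evalH u) (evalH v)) ∣-refl)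

-- Equality in Rᵃᵇ

module Rᵃᵇ (n : ℕ) where

  InRR-conj : ∀ g {u} → InRR n u → InRR n (conj g u)
  InRR-conj g (rr-comm {r} {s} r∈R s∈R) =
    rr-resp (∼-sym (conj-comm g r s))
      (rr-comm {r = conj g r} {s = conj g s} (InR-conj n g r r∈R) (InR-conj n g s s∈R))
  InRR-conj g rr-one =
    rr-resp (∼-sym (conj-[] g)) rr-one
  InRR-conj g (rr-mul {u} {v} p q) =
    rr-resp (∼-sym (conj-++ g u v)) (rr-mul (InRR-conj g p) (InRR-conj g q))
  InRR-conj g (rr-inv {u} p) =
    subst (InRR n) (inv-conj g u) (rr-inv (InRR-conj g p))
  InRR-conj g (rr-resp u∼v p) =
    rr-resp (conj-cong g u∼v) (InRR-conj g p)

  -- x ≈[ n ] y unfolds to InRR n (x ++ inv y), from which Agda cannot recover x and y.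
  record _≈_ (x y : Word) : Set where
    constructor wrap
    field unwrap : x ≈[ n ] y
  open _≈_ public

  ∼⇒≈ : ∀ {x y} → x ∼ y → x ≈ y
  ∼⇒≈ {x} {y} x∼y = wrap (rr-resp (∼-sym (∼-trans (++-congʳ (inv y) x∼y) (++-inverseʳ y))) rr-one)

  ≈-refl : ∀ {x} → x ≈ x
  ≈-refl = ∼⇒≈ ∼-refl

  ≈-sym : ∀ {x y} → x ≈ y → y ≈ x
  ≈-sym {x} {y} (wrap p) = wrap (subst (InRR n) inv≡ (rr-inv p))
    where
    inv≡ : inv (x ++ inv y) ≡ y ++ inv x
    inv≡ = trans (inv-++ x (inv y)) (cong (_++ inv x) (inv-involutive y))

  ≈-trans : ∀ {x y z} → x ≈ y → y ≈ z → x ≈ z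
  ≈-trans {x} {y} {z} (wrap p) (wrap q) = wrap (rr-resp (begin
    (x ++ inv y) ++ (y ++ inv z)  ≡⟨ Monoid.solve (++-monoid Letter) ⟩
    x ++ (inv y ++ y) ++ inv z    ∼⟨ erase x (inv z) (++-inverseˡ y) ⟩
    x ++ inv z                    ∎) (rr-mul p q))
    where open ∼-Reasoning

  ≈-setoid : Setoid _ _
  ≈-setoid = record
    { Carrier       = Word
    ; _≈_           = _≈_
    ; isEquivalence = record { refl = ≈-refl ; sym = ≈-sym ; trans = ≈-trans }
    }

  module ≈-Reasoning where
    open SetoidReasoning ≈-setoid public
    open ∼-syntax _IsRelatedTo_ _IsRelatedTo_ (λ x∼y → ≈-go (∼⇒≈ x∼y)) public

  ≈-congˡ : ∀ g {x y} → x ≈ y → (g ++ x) ≈ (g ++ y)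
  ≈-congˡ g {x} {y} (wrap p) = wrap (subst (InRR n) conj≡ (InRR-conj g p))
    where
    open ≡-Reasoning
    conj≡ : conj g (x ++ inv y) ≡ (g ++ x) ++ inv (g ++ y)
    conj≡ = begin
      g ++ (x ++ inv y) ++ inv g     ≡⟨ Monoid.solve (++-monoid Letter) ⟩
      (g ++ x) ++ (inv y ++ inv g)   ≡⟨ cong ((g ++ x) ++_) (inv-++ g y) ⟨
      (g ++ x) ++ inv (g ++ y)       ∎

  ≈-congʳ : ∀ g {x y} → x ≈ y → (x ++ g) ≈ (y ++ g)
  ≈-congʳ g {x} {y} (wrap p) = wrap (rr-resp insert p)
    where
    open ∼-Reasoning
    insert : (x ++ inv y) ∼ ((x ++ g) ++ inv (y ++ g))
    insert = begin
      x ++ inv y                     ∼⟨ ∼-sym (erase x (inv y) (++-inverseʳ g)) ⟩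
      x ++ (g ++ inv g) ++ inv y     ≡⟨ Monoid.solve (++-monoid Letter) ⟩
      (x ++ g) ++ (inv g ++ inv y)   ≡⟨ cong ((x ++ g) ++_) (inv-++ y g) ⟨
      (x ++ g) ++ inv (y ++ g)       ∎

  ≈-cong : ∀ {x x′ y y′} → x ≈ x′ → y ≈ y′ → (x ++ y) ≈ (x′ ++ y′)
  ≈-cong {x′ = x′} {y = y} x≈x′ y≈y′ = ≈-trans (≈-congʳ y x≈x′) (≈-congˡ x′ y≈y′)

  ≈-conj : ∀ g {x y} → x ≈ y → conj g x ≈ conj g y
  ≈-conj g x≈y = ≈-congˡ g (≈-congʳ (inv g) x≈y)

  ++-comm-≈ : ∀ r s → InR n r → InR n s → (r ++ s) ≈ (s ++ r)
  ++-comm-≈ r s r∈R s∈R = wrap (subst (InRR n) comm≡ (rr-comm {r = r} {s = s} r∈R s∈R))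
    where
    open ≡-Reasoning
    comm≡ : comm r s ≡ (r ++ s) ++ inv (s ++ r)
    comm≡ = begin
      r ++ s ++ inv r ++ inv s       ≡⟨ Monoid.solve (++-monoid Letter) ⟩
      (r ++ s) ++ (inv r ++ inv s)   ≡⟨ cong ((r ++ s) ++_) (inv-++ s r) ⟨
      (r ++ s) ++ inv (s ++ r)       ∎

  conj-≈ : ∀ w r → InR n w → InR n r → conj w r ≈ r
  conj-≈ w r w∈R r∈R = wrap (subst (InRR n) comm≡ (rr-comm {r = w} {s = r} w∈R r∈R))
    where
    comm≡ : comm w r ≡ conj w r ++ inv r
    comm≡ = Monoid.solve (++-monoid Letter)

  comm-pow-≈ : ∀ g z m → InR n (comm g z) →
    comm (pow g m) z ≈ Σ (upTo m) (λ l → conj (pow g l) (comm g z))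
  comm-pow-≈ g z zero    _   = ∼⇒≈ (++-inverseʳ z)
  comm-pow-≈ g z (suc m) c∈R = begin
    comm (g ++ pow g m) z           ∼⟨ comm-++ˡ g (pow g m) z ⟩
    conj g (comm (pow g m) z) ++ c  ≈⟨ ≈-congʳ c (≈-conj g (comm-pow-≈ g z m c∈R)) ⟩
    conj g (Σ (upTo m) f) ++ c      ∼⟨ ++-congʳ c (conj-Σ g (upTo m) f) ⟩
    Σ (upTo m) (conj g ∘ f) ++ c    ∼⟨ ++-congʳ c (Σ-cong (upTo m) (∼-reflexive ∘ conj-f)) ⟩
    Σ (upTo m) (f ∘ suc) ++ c       ≈⟨ ++-comm-≈ _ c (InR-Σ n (upTo m) (f ∘ suc) f-suc∈R) c∈R ⟩
    c ++ Σ (upTo m) (f ∘ suc)       ≡⟨ cong (_++ Σ (upTo m) (f ∘ suc)) (++-identityʳ c) ⟨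
    f 0 ++ Σ (upTo m) (f ∘ suc)     ≡⟨ Σ-upTo-suc m f ⟨
    Σ (upTo (suc m)) f              ∎
    where
    open ≈-Reasoning
    c = comm g z
    f : ℕ → Word
    f l = conj (pow g l) c
    conj-f : ∀ l → conj g (f l) ≡ f (suc l)
    conj-f l = conj-conj g (pow g l) c
    f-suc∈R : ∀ l → InR n (f (suc l))
    f-suc∈R l = InR-conj n (pow g (suc l)) c c∈R

  comm-pow-++-pow-≈ : ∀ g h z i j → InR n (comm g z) → InR n (comm h z) →
    comm (pow g i ++ pow h j) z ≈
      (Σ (upTo j) (λ l → conj (pow g i ++ pow h l) (comm h z))
       ++ Σ (upTo i) (λ l → conj (pow g l) (comm g z)))
  comm-pow-++-pow-≈ g h z i j g∈R h∈R = begin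
    comm (gⁱ ++ pow h j) z
      ∼⟨ comm-++ˡ gⁱ (pow h j) z ⟩
    conj gⁱ (comm (pow h j) z) ++ comm gⁱ z
      ≈⟨ ≈-cong (≈-conj gⁱ (comm-pow-≈ h z j h∈R)) (comm-pow-≈ g z i g∈R) ⟩
    conj gⁱ (Σ (upTo j) fh) ++ Σ (upTo i) fg
      ∼⟨ ++-congʳ (Σ (upTo i) fg) (∼-trans (conj-Σ gⁱ (upTo j) fh)
           (Σ-cong (upTo j) λ l → ∼-reflexive (conj-conj gⁱ (pow h l) (comm h z)))) ⟩
    Σ (upTo j) (λ l → conj (gⁱ ++ pow h l) (comm h z)) ++ Σ (upTo i) fg
      ∎
    where
    open ≈-Reasoning
    gⁱ = pow g i
    fg fh : ℕ → Word
    fg l = conj (pow g l) (comm g z)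
    fh l = conj (pow h l) (comm h z)

  comm-pow-≈-nestedSum : ∀ g h m → comm (pow g m) h ≈ (nestedSum g h m ++ pow (comm g h) m)
  comm-pow-≈-nestedSum g h zero    = ∼⇒≈ (++-inverseʳ h)
  comm-pow-≈-nestedSum g h (suc m) = begin
    comm (pow g (suc m)) h           ≡⟨ cong (λ w → comm w h) (pow-suc-snoc g m) ⟩
    comm (gᵐ ++ g) h                 ∼⟨ comm-++ˡ gᵐ g h ⟩
    conj gᵐ t ++ comm gᵐ h           ∼⟨ ++-congʳ (comm gᵐ h) (conj-as-comm gᵐ t) ⟩
    (comm gᵐ t ++ t) ++ comm gᵐ h    ≈⟨ ≈-cong (≈-congʳ t (comm-pow-≈ g t m (InR-comm-comm n g g h)))
                                              (comm-pow-≈-nestedSum g h m) ⟩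
    (P ++ t) ++ (S ++ tᵐ)            ≡⟨ Monoid.solve (++-monoid Letter) ⟩
    (P ++ t ++ S) ++ tᵐ              ∼⟨ ∼-sym (erase (P ++ t ++ S) tᵐ (++-inverseˡ t)) ⟩
    (P ++ t ++ S) ++ (inv t ++ t) ++ tᵐ ≡⟨ Monoid.solve (++-monoid Letter) ⟩
    (P ++ conj t S) ++ t ++ tᵐ       ∼⟨ ++-congʳ (t ++ tᵐ) (nestedSum-suc g h m) ⟩
    nestedSum g h (suc m) ++ pow t (suc m) ∎
    where
    open ≈-Reasoning
    gᵐ = pow g m
    t  = comm g h
    tᵐ = pow t m
    S  = nestedSum g h m
    P  = Σ (upTo m) (λ i → conj (pow g i) (comm g t))

  pow-comm-≈ : ∀ g h →
    pow (comm g h) n ≈ (pow g n ++ inv (conj h (pow g n)) ++ inv (nestedSum g h n))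
  pow-comm-≈ g h = ≈-sym (begin
    gⁿ ++ inv (conj h gⁿ) ++ inv S   ≡⟨ cong (λ w → gⁿ ++ w ++ inv S) (inv-conj h gⁿ) ⟩
    gⁿ ++ conj h (inv gⁿ) ++ inv S   ≡⟨ Monoid.solve (++-monoid Letter) ⟩
    comm gⁿ h ++ inv S               ≈⟨ ≈-congʳ (inv S) (comm-pow-≈-nestedSum g h n) ⟩
    (S ++ tⁿ) ++ inv S               ≡⟨ ++-assoc S tⁿ (inv S) ⟩
    conj S tⁿ                        ≈⟨ conj-≈ S tⁿ S∈R (InR-pow-comm n g h) ⟩
    tⁿ                               ∎)
    where
    open ≈-Reasoning
    gⁿ = pow g n
    tⁿ = pow (comm g h) n
    S  = nestedSum g h n
    S∈R : InR n S
    S∈R = InR-Σ n (upTo (n ∸ 1)) _ λ k → InR-Σ n (upTo (n ∸ 1 ∸ k)) _ λ i →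
            InR-conj n (pow (comm g h) k ++ pow g i) (comm g (comm g h)) (InR-comm-comm n g g h)

lemma2p11 : (n : ℕ) →
    InR n (pow T n)
    × (∀ i j → InR n (pow Ti n ++ comm (pow A i ++ pow B j) T))
    × (pow T n ≈[ n ] (pow A n ++ inv (conj B (pow A n))
         ++ inv (Σ (upTo (n ∸ 1)) (λ k → Σ (upTo (n ∸ 1 ∸ k)) (λ i →
                  conj (pow T k ++ pow A i) (comm A T))))))
    × (pow Ti n ≈[ n ] (pow B n ++ inv (conj A (pow B n))
         ++ inv (Σ (upTo (n ∸ 1)) (λ k → Σ (upTo (n ∸ 1 ∸ k)) (λ j →
                  conj (pow Ti k ++ pow B j) (comm B Ti))))))
    × (∀ i j → comm (pow A i ++ pow B j) T ≈[ n ]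
         (Σ (upTo j) (λ l → conj (pow A i ++ pow B l) (comm B T))
          ++ Σ (upTo i) (λ l → conj (pow A l) (comm A T))))
lemma2p11 n =
  InR-pow-comm n A B ,
  (λ i j → InR-++ n (pow Ti n) _ (InR-pow-comm n B A)
                   (InR-comm-comm n (pow A i ++ pow B j) A B)) ,
  unwrap (pow-comm-≈ A B) ,
  -- the words comm B A and Ti coincide
  unwrap (pow-comm-≈ B A) ,
  (λ i j → unwrap (comm-pow-++-pow-≈ A B T i j (InR-comm-comm n A A B) (InR-comm-comm n B A B)))
  where open Rᵃᵇ n
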